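{- Let $G=(V,E)$ and the algorithm be as described in the context, executed under the distributed adversarial daemon. In any execution, every process executes at most two Update moves.
   Context: Let $G=(V,E)$ be a finite simple undirected graph; each node is a process and $N(i)$ denotes the set of neighbours of $i$. Each process has an identifier from a totally ordered set; identifiers of any two distinct processes at distance at most $2$ are distinct, and comparisons such as $j>i$ between processes are comparisons of their identifiers. Each process $i$ holds variables $m_i\in\{\text{true},\text{false}\}$ and $p_i\in\{null\}\cup N(i)$; a configuration is an assignment of values to all these variables. Define the predicate $PRmarried(i)\equiv \exists j\in N(i): (p_i=j \text{ and } p_j=i)$. The algorithm consists of the following four guarded rules for each process $i$ (a rule is enabled at $i$ if its guard holds; at most one rule is enabled at a process at any time): Update: if $m_i\neq PRmarried(i)$ then $m_i:=PRmarried(i)$. Marriage: if $m_i=PRmarried(i)$ and $p_i=null$ and there is $j\in N(i)$ with $p_j=i$, then $p_i:=j$ (for such a $j$). Seduction: if $m_i=PRmarried(i)$ and $p_i=null$ and $p_k\neq i$ for all $k\in N(i)$ and there is $j\in N(i)$ with $p_j=null$, $j>i$ and $m_j=\text{false}$, then $p_i:=\max\{j\in N(i): p_j=null,\ j>i,\ m_j=\text{false}\}$. Abandonment: if $m_i=PRmarried(i)$ and $p_i=j\neq null$ and $p_j\neq i$ and ($m_j=\text{true}$ or $j\le i$), then $p_i:=null$. A process is eligible if some rule is enabled at it. Under the distributed adversarial daemon, a step from a configuration $C$ consists of an arbitrary nonempty subset of the processes eligible in $C$ each executing its enabled rule, all guards and assignments being evaluated in $C$ (simultaneous execution); an execution is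 a maximal sequence of configurations, starting from an arbitrary configuration, each obtained from the previous one by a step. The execution of a rule by a process is a move (an Update move is an execution of the Update rule). -}

module Defs where

open import Level using (Level; _⊔_) renaming (suc to lsuc; zero to lzero)
open import Data.Nat using (ℕ; zero; suc; _+_)
open import Data.Fin using (Fin)
open import Data.Bool using (Bool; true; false; _∧_; if_then_else_)
open import Data.Maybe using (Maybe; just; nothing)
open import Data.Product using (Σ; ∃; _×_; _,_)
open import Data.Sum using (_⊎_)
open import Data.Empty using (⊥)
open import Relation.Nullary using (¬_)
open import Relation.Binary.PropositionalEquality using (_≡_; _≢_)
open import Relation.Binary.Bundles using (StrictTotalOrder)

record Network {a ℓ₁ ℓ₂ : Level} (O : StrictTotalOrder a ℓ₁ ℓ₂) : Set (lsuc lzero ⊔ a ⊔ ℓ₁) where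
  open StrictTotalOrder O renaming (Carrier to Id)
  field
    n      : ℕ
    Adj    : Fin n → Fin n → Set
    sym    : ∀ {i j} → Adj i j → Adj j i
    irrefl : ∀ {i} → ¬ Adj i i
    ident  : Fin n → Id
    distinct : ∀ {i j} → i ≢ j → (Adj i j ⊎ Σ (Fin n) (λ k → Adj i k × Adj k j))
             → ¬ (ident i ≈ ident j)

module Algorithm {a ℓ₁ ℓ₂ : Level} {O : StrictTotalOrder a ℓ₁ ℓ₂} (G : Network O) where
  open StrictTotalOrder O using (_<_)
  open Network G

  _>ᵢ_ : Fin n → Fin n → Set ℓ₂
  j >ᵢ i = ident i < ident j

  _≤ᵢ_ : Fin n → Fin n → Set ℓ₂
  j ≤ᵢ i = ¬ (ident i < ident j)

  -- a configuration: m_i ∈ Bool, p_i ∈ {null} ∪ N(i)  (null = nothing)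
  record Config : Set where
    field
      m  : Fin n → Bool
      p  : Fin n → Maybe (Fin n)
      wf : ∀ i j → p i ≡ just j → Adj i j
  open Config public

  PRmarried : Config → Fin n → Set
  PRmarried C i = Σ (Fin n) λ j → Adj i j × p C i ≡ just j × p C j ≡ just i

  Agrees : Config → Fin n → Set
  Agrees C i = (m C i ≡ true → PRmarried C i) × (PRmarried C i → m C i ≡ true)

  data Rule : Set where
    update marriage seduction abandonment : Rule

  isUpdate : Rule → Bool
  isUpdate update = true
  isUpdate _      = false

  Candidate : Config → Fin n → Fin n → Set ℓ₂
  Candidate C i j = Adj i j × p C j ≡ nothing × j >ᵢ i × m C j ≡ false

  -- Move C i r (b , q): in configuration C, process i executes rule r,
  -- after which its new values are m_i = b and p_i = q.
  data Move (C : Config) (i : Fin n) : Rule → Bool × Maybe (Fin n) → Set (ℓ₁ ⊔ ℓ₂) where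
    mvUpdate : (b : Bool) → ¬ Agrees C i
             → (b ≡ true → PRmarried C i) → (PRmarried C i → b ≡ true)
             → Move C i update (b , p C i)
    mvMarriage : (j : Fin n) → Agrees C i → p C i ≡ nothing
               → Adj i j → p C j ≡ just i
               → Move C i marriage (m C i , just j)
    mvSeduction : (j : Fin n) → Agrees C i → p C i ≡ nothing
                → (∀ k → Adj i k → p C k ≢ just i)
                → Candidate C i j
                → (∀ k → Candidate C i k → k ≤ᵢ j)
                → Move C i seduction (m C i , just j)
    mvAbandonment : (j : Fin n) → Agrees C i → p C i ≡ just j
                  → p C j ≢ just i → (m C j ≡ true ⊎ j ≤ᵢ i)
                  → Move C i abandonment (m C i , nothing)

  -- one step of the distributed daemon: a nonempty set of processes
  -- (each necessarily eligible, since it executes an enabled rule)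
  -- moves simultaneously, all guards evaluated in C.
  record Step (C C' : Config) : Set (ℓ₁ ⊔ ℓ₂) where
    field
      active   : Fin n → Bool
      nonempty : ∃ λ i → active i ≡ true
      rule     : Fin n → Rule
      moves    : ∀ i → active i ≡ true → Move C i (rule i) (m C' i , p C' i)
      idle     : ∀ i → active i ≡ false → m C' i ≡ m C i × p C' i ≡ p C i

  updateMoves : ∀ {C C'} → Step C C' → Fin n → ℕ
  updateMoves s i = if Step.active s i ∧ isUpdate (Step.rule s i) then 1 else 0

  data Trace : Config → Config → Set (ℓ₁ ⊔ ℓ₂) where
    done : ∀ {C} → Trace C C
    _∷_  : ∀ {C C' C''} → Step C C' → Trace C' C'' → Trace C C''

  #updates : ∀ {C C'} → Trace C C' → Fin n → ℕ
  #updates done     i = 0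
  #updates (s ∷ t)  i = updateMoves s i + #updates t i

module Submission where

-- A married pair (p_i = j, p_j = i) is never broken: Marriage and Seduction need p_i = null and
-- Abandonment needs p_j ≠ i.  So an Update move either raises m_i to true at a married process,
-- after which m_i stays correct forever, or lowers m_i to false at an unmarried one, after which
-- the only possible Update is a raise.  Hence at most a lowering followed by a raise.

open import Defs
open import Level using (Level)
open import Data.Fin using (Fin)
open import Data.Nat using (ℕ; _≤_; z≤n; s≤s)
open import Data.Bool using (Bool; true; false; if_then_else_)
open import Data.Maybe using (Maybe)
open import Data.Maybe.Properties using (just-injective)
open import Data.Product using (_,_)
open import Data.Empty using (⊥-elim)
open import Relation.Nullary using (¬_)
open import Relation.Binary.PropositionalEquality using (_≡_; _≢_; refl; sym; trans)
open import Relation.Binary.Bundles using (StrictTotalOrder)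

module _ {a ℓ₁ ℓ₂ : Level} {O : StrictTotalOrder a ℓ₁ ℓ₂} (G : Network O) where
  open Network G using (n)
  open Algorithm G

  -- The effect on process i of one step: k Update moves, new values m_i = b and p_i = q.
  data Transition (C : Config) (i : Fin n) (k : ℕ) (b : Bool) (q : Maybe (Fin n)) : Set where
    keep  : k ≡ 0 → b ≡ m C i → (PRmarried C i → q ≡ p C i) → Transition C i k b q
    raise : k ≡ 1 → PRmarried C i → m C i ≡ false → b ≡ true → q ≡ p C i → Transition C i k b q
    lower : k ≡ 1 → ¬ PRmarried C i → m C i ≡ true → b ≡ false → Transition C i k b q

  transition-keeps-p-of-married : ∀ {C i k b q} → Transition C i k b q → PRmarried C i → q ≡ p C i
  transition-keeps-p-of-married (keep _ _ q≡p) married = q≡p married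
  transition-keeps-p-of-married (raise _ _ _ _ q≡p) _   = q≡p
  transition-keeps-p-of-married (lower _ unmarried _ _) married = ⊥-elim (unmarried married)

  false≢true : false ≢ true
  false≢true ()

  update-transition : ∀ {C i} b → ¬ Agrees C i → (b ≡ true → PRmarried C i)
                    → (PRmarried C i → b ≡ true) → Transition C i 1 b (p C i)
  update-transition {C} {i} true disagrees sound _ with m C i in mᵢ
  ... | false = raise refl (sound refl) mᵢ refl refl
  ... | true  = ⊥-elim (disagrees (sound , λ _ → refl))
  update-transition {C} {i} false disagrees _ complete with m C i in mᵢ
  ... | true  = lower refl (λ married → false≢true (complete married)) mᵢ refl
  ... | false = ⊥-elim (disagrees ((λ ()) , complete))

  move-keeps-p-of-married : ∀ {C i r b q} → Move C i r (b , q) → PRmarried C i → q ≡ p C i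
  move-keeps-p-of-married (mvUpdate _ _ _ _) _ = refl
  move-keeps-p-of-married (mvMarriage _ _ pᵢ≡null _ _) (_ , _ , pᵢ≡j , _)
    with () ← trans (sym pᵢ≡null) pᵢ≡j
  move-keeps-p-of-married (mvSeduction _ _ pᵢ≡null _ _ _) (_ , _ , pᵢ≡j , _)
    with () ← trans (sym pᵢ≡null) pᵢ≡j
  move-keeps-p-of-married (mvAbandonment _ _ pᵢ≡j pⱼ≢i _) (_ , _ , pᵢ≡k , pₖ≡i)
    with refl ← just-injective (trans (sym pᵢ≡j) pᵢ≡k) = ⊥-elim (pⱼ≢i pₖ≡i)

  move-transition : ∀ {C i r b q} → Move C i r (b , q)
                  → Transition C i (if isUpdate r then 1 else 0) b q
  move-transition (mvUpdate b disagrees sound complete) = update-transition b disagrees sound complete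
  move-transition mv@(mvMarriage _ _ _ _ _)      = keep refl refl (move-keeps-p-of-married mv)
  move-transition mv@(mvSeduction _ _ _ _ _ _)   = keep refl refl (move-keeps-p-of-married mv)
  move-transition mv@(mvAbandonment _ _ _ _ _)   = keep refl refl (move-keeps-p-of-married mv)

  step-transition : ∀ {C C'} (s : Step C C') i → Transition C i (updateMoves s i) (m C' i) (p C' i)
  step-transition s i with Step.active s i in active
  ... | false = let m≡ , p≡ = Step.idle s i active in keep refl m≡ (λ _ → p≡)
  ... | true  = move-transition (Step.moves s i active)

  step-preserves-married : ∀ {C C'} (s : Step C C') i → PRmarried C i → PRmarried C' i
  step-preserves-married s i married@(j , i~j , pᵢ≡j , pⱼ≡i) =
      j , i~j
    , trans (transition-keeps-p-of-married (step-transition s i) married) pᵢ≡j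
    , trans (transition-keeps-p-of-married (step-transition s j) (i , Network.sym G i~j , pⱼ≡i , pᵢ≡j)) pⱼ≡i

  #updates-married-set≡0 : ∀ {C C'} (t : Trace C C') i → PRmarried C i → m C i ≡ true → #updates t i ≡ 0
  #updates-married-set≡0 done i _ _ = refl
  #updates-married-set≡0 (s ∷ t) i married set with step-transition s i
  ... | keep k≡0 m≡ _ rewrite k≡0 =
    #updates-married-set≡0 t i (step-preserves-married s i married) (trans m≡ set)
  ... | raise _ _ unset _ _ with () ← trans (sym set) unset
  ... | lower _ unmarried _ _ = ⊥-elim (unmarried married)

  #updates-married≤1 : ∀ {C C'} (t : Trace C C') i → PRmarried C i → #updates t i ≤ 1
  #updates-married≤1 done i _ = z≤n
  #updates-married≤1 (s ∷ t) i married with step-transition s i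
  ... | keep k≡0 _ _ rewrite k≡0 = #updates-married≤1 t i (step-preserves-married s i married)
  ... | raise k≡1 _ _ set _
    rewrite k≡1 | #updates-married-set≡0 t i (step-preserves-married s i married) set = s≤s z≤n
  ... | lower _ unmarried _ _ = ⊥-elim (unmarried married)

  #updates-unset≤1 : ∀ {C C'} (t : Trace C C') i → m C i ≡ false → #updates t i ≤ 1
  #updates-unset≤1 done i _ = z≤n
  #updates-unset≤1 (s ∷ t) i unset with step-transition s i
  ... | keep k≡0 m≡ _ rewrite k≡0 = #updates-unset≤1 t i (trans m≡ unset)
  ... | raise k≡1 married _ set _
    rewrite k≡1 | #updates-married-set≡0 t i (step-preserves-married s i married) set = s≤s z≤n
  ... | lower _ _ set _ with () ← trans (sym unset) set

  #updates≤2 : ∀ {C C'} (t : Trace C C') i → #updates t i ≤ 2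
  #updates≤2 done i = z≤n
  #updates≤2 (s ∷ t) i with step-transition s i
  ... | keep k≡0 _ _ rewrite k≡0 = #updates≤2 t i
  ... | raise k≡1 married _ _ _ rewrite k≡1 =
    s≤s (#updates-married≤1 t i (step-preserves-married s i married))
  ... | lower k≡1 _ _ unset rewrite k≡1 = s≤s (#updates-unset≤1 t i unset)

corollary3 : ∀ {a ℓ₁ ℓ₂ : Level} {O : StrictTotalOrder a ℓ₁ ℓ₂} (G : Network O)
    → let open Algorithm G in
    ∀ {C₀ C} (t : Trace C₀ C) i → #updates t i ≤ 2
corollary3 G = #updates≤2 G
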